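{- Let $\chi$ be a skew shape, $n\ge 1$, $T\in\mathrm{Tab}(\chi,n)$, and let $\nu/\kappa$ be a skew shape (partitions $\kappa\subseteq\nu$, viewed as elements of $\mathbb{N}^n$) with $\nu-\kappa=\mathrm{wt}\,T$. Then the following are equivalent: (1) $T$ is $\nu/\kappa$-dominant; (2) for all $i\in\{0,\dots,n-2\}$, the operation $e_i$ cannot be applied more than $\kappa_i-\kappa_{i+1}$ times successively to $T$; (3) for all $i\in\{0,\dots,n-2\}$, the operation $f_i$ cannot be applied more than $\nu_i-\nu_{i+1}$ times successively to $T$.
   Context: For partitions $\mu\subseteq\lambda$, $Y(\lambda/\mu)=\{(i,j):\mu_i\le j<\lambda_i\}$ (row $i$ from $0$ at the top, column $j$ from the left). $\mathrm{Tab}(\chi,n)$ is the set of semistandard tableaux of shape $\chi$ with entries in $\{0,\dots,n-1\}$ (weakly increasing along rows, strictly increasing down columns); $\mathrm{wt}\,T\in\mathbb{N}^n$ has $i$-th component the number of entries $i$. $T$ is $\kappa$-dominant if, reading its entries in Semitic order (rows top to bottom, each row right to left), starting with $\alpha=\kappa$ and increasing $\alpha_i$ by $1$ for each entry $i$ read, $\alpha$ is a partition (weakly decreasing) at every stage; $T$ is $\nu/\kappa$-dominant if it is $\kappa$-dominant and $\mathrm{wt}\,T=\nu-\kappa$ (equivalently, $T$ has a companion tableau of shape $\nu/\kappa$). Coplactic operations: for a word $w$ over $\{0,\dots,n-1\}$ and $i\in\{0,\dots,n-2\}$, $w$ is dominant for $i$ if every prefix has at least as many letters $i$ as $i+1$,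 anti-dominant for $i$ if every suffix has at least as many letters $i+1$ as $i$; if $w=u\,i\,v$ and $w'=u\,(i+1)\,v$ with $u$ anti-dominant and $v$ dominant for $i$, then $f_i(w)=w'$ and $e_i(w')=w$. For a tableau $T$, $e_i(T)$ (resp. $f_i(T)$) is defined iff $e_i$ (resp. $f_i$) is defined on the word of entries of $T$ read in a valid reading order (a total order $\le_r$ on squares with $(i,j)\le_r(i',j')$ whenever $i\le i'$ and $j\ge j'$), and is obtained by decreasing (resp. increasing) by $1$ the corresponding entry of $T$; this is independent of the valid reading order. "$e_i$ cannot be applied more than $m$ times successively to $T$" means $e_i^{m+1}(T)$ is undefined. -}

module Defs where

open import Data.Nat using (ℕ; zero; suc; _+_; _∸_; _≤_; _<_; _≟_)
open import Relation.Nullary using (yes; no)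
open import Data.List using (List; []; _∷_; _++_; length; map; concat; reverse)
open import Data.Vec using (Vec; toList)
open import Data.Product using (Σ; ∃; _×_; _,_)
open import Relation.Binary.PropositionalEquality using (_≡_)
open import Relation.Nullary using (¬_)

-- Indexing lists with a default value (used for padding partitions
-- with zeros and for rows of a tableau outside the shape).

nth : {A : Set} → A → List A → ℕ → A
nth d []       _       = d
nth d (x ∷ xs) zero    = x
nth d (x ∷ xs) (suc k) = nth d xs k

part : List ℕ → ℕ → ℕ
part = nth 0

-- i-th component of a vector in ℕ^n (0 for i ≥ n, never used there)
_!_ : {n : ℕ} → Vec ℕ n → ℕ → ℕ
v ! i = part (toList v) i

IsPartition : List ℕ → Set
IsPartition l = ∀ r → part l (suc r) ≤ part l r

IsSkewShape : List ℕ → List ℕ → Set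
IsSkewShape lam mu = IsPartition lam × IsPartition mu × (∀ r → part mu r ≤ part lam r)

InY : List ℕ → List ℕ → ℕ → ℕ → Set
InY lam mu r j = part mu r ≤ j × j < part lam r

IsPartitionV : {n : ℕ} → Vec ℕ n → Set
IsPartitionV {n} v = ∀ i → suc i < n → v ! suc i ≤ v ! i

-- Tableaux.  A filling of λ/μ is a list of rows; row r lists the entries
-- of the squares (r , j), μ_r ≤ j < λ_r, from left to right.

Filling : Set
Filling = List (List ℕ)

row : Filling → ℕ → List ℕ
row = nth []

-- entry of T at square (r , j)  (meaningful for (r , j) ∈ Y(λ/μ))
entry : List ℕ → Filling → ℕ → ℕ → ℕ
entry mu T r j = part (row T r) (j ∸ part mu r)

IsTab : ℕ → List ℕ → List ℕ → Filling → Set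
IsTab n lam mu T =
    length T ≡ length lam
  × (∀ r → length (row T r) ≡ part lam r ∸ part mu r)
  × (∀ r j → InY lam mu r j → entry mu T r j < n)
  × (∀ r j → InY lam mu r j → InY lam mu r (suc j) →
       entry mu T r j ≤ entry mu T r (suc j))
  × (∀ r j → InY lam mu r j → InY lam mu (suc r) j →
       entry mu T r j < entry mu T (suc r) j)

Word : Set
Word = List ℕ

count : ℕ → Word → ℕ
count a []       = 0
count a (x ∷ xs) with a ≟ x
... | yes _ = suc (count a xs)
... | no  _ = count a xs

word : Filling → Word
word T = concat (map reverse T)

Dominant : ℕ → Word → Set
Dominant i w = ∀ u v → w ≡ u ++ v → count (suc i) u ≤ count i u

AntiDominant : ℕ → Word → Set
AntiDominant i w = ∀ u v → w ≡ u ++ v → count i v ≤ count (suc i) v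

E : ℕ → Word → Word → Set
E i w w' = Σ Word λ u → Σ Word λ v →
  AntiDominant i u × Dominant i v × w ≡ u ++ (suc i ∷ v) × w' ≡ u ++ (i ∷ v)

F : ℕ → Word → Word → Set
F i w w' = Σ Word λ u → Σ Word λ v →
  AntiDominant i u × Dominant i v × w ≡ u ++ (i ∷ v) × w' ≡ u ++ (suc i ∷ v)

-- coplactic operations on tableaux: same shape, the reading word changes
-- by the word operation (i.e. the corresponding entry is decreased /
-- increased by one)
ETab : ℕ → Filling → Filling → Set
ETab i T T' = map length T' ≡ map length T × E i (word T) (word T')

FTab : ℕ → Filling → Filling → Set
FTab i T T' = map length T' ≡ map length T × F i (word T) (word T')

Iter : {A : Set} → (A → A → Set) → ℕ → A → A → Set
Iter R zero    x y = x ≡ y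
Iter R (suc m) x z = Σ _ λ y → R x y × Iter R m y z

AtMost : (Filling → Filling → Set) → ℕ → Filling → Set
AtMost R m T = ¬ (Σ Filling λ T' → Iter R (suc m) T T')

WtEq : {n : ℕ} → Vec ℕ n → Vec ℕ n → Filling → Set
WtEq {n} κ ν T = ∀ i → i < n → ν ! i ≡ κ ! i + count i (word T)

-- κ-dominant: starting from α = κ and adding e_i for each letter read in
-- Semitic order, α stays weakly decreasing at every stage
KappaDominant : {n : ℕ} → Vec ℕ n → Filling → Set
KappaDominant {n} κ T = ∀ p s → word T ≡ p ++ s → ∀ i → suc i < n →
  κ ! suc i + count (suc i) p ≤ κ ! i + count i p

NuKappaDominant : {n : ℕ} → Vec ℕ n → Vec ℕ n → Filling → Set
NuKappaDominant κ ν T = KappaDominant κ T × WtEq κ ν T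

module Submission where

-- Fix a letter i.  The excess of a prefix of a word is its number of letters
-- i+1 minus its number of letters i.  The letter i+1 that e_i changes sits where
-- the prefix excess first reaches its maximum, so e_i lowers that maximum by one
-- and can be applied exactly (maximal prefix excess) times in a row; dually f_i
-- can be applied exactly as often as the maximal excess of i over i+1 in a
-- suffix.  κ-dominance of T says that the prefix excess of its reading word never
-- exceeds κ_i − κ_{i+1}, and when wt T = ν − κ this is equivalent to the suffix
-- excess never exceeding ν_i − ν_{i+1}.

open import Defs
open import Data.Nat using (ℕ; zero; suc; _+_; _∸_; _≤_; _<_; _≟_; _≤?_; z≤n; s≤s)
open import Data.Nat.Properties
open import Data.Nat.Tactic.RingSolver using (solve)
open import Data.List using (List; []; _∷_; _++_; length; map; reverse; take; drop)
open import Data.List.Properties using (∷-injectiveˡ; ∷-injectiveʳ; ++-identityʳ; ∷ʳ-++;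
  length-++; length-take; length-drop; length-reverse; reverse-involutive; take++drop≡id)
open import Data.Product using (Σ; _×_; _,_; proj₁; proj₂)
open import Data.Vec using (Vec)
open import Data.Sum using (_⊎_; inj₁; inj₂)
open import Data.Empty using (⊥-elim)
open import Relation.Nullary using (¬_; yes; no)
open import Relation.Binary.PropositionalEquality
open import Function.Base using (_∘_)
open import Function.Bundles using (_⇔_; mk⇔; Equivalence)
open import Function.Construct.Composition using (_⇔-∘_)
open import Function.Construct.Symmetry using (⇔-sym)

≤-rearrange : ∀ {l r a b} x y → a ≤ b → l + x ≡ a + y → b + y ≡ r + x → l ≤ r
≤-rearrange {l} {r} x y a≤b l≡a b≡r =
  +-cancelʳ-≤ x l r (subst₂ _≤_ (sym l≡a) b≡r (+-monoˡ-≤ y a≤b))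

count-++ : ∀ a u v → count a (u ++ v) ≡ count a u + count a v
count-++ a [] v = refl
count-++ a (x ∷ u) v with a ≟ x
... | yes _ = cong suc (count-++ a u v)
... | no _ = count-++ a u v

count-∷-≡ : ∀ a w → count a (a ∷ w) ≡ suc (count a w)
count-∷-≡ a w with a ≟ a
... | yes _ = refl
... | no a≢a = ⊥-elim (a≢a refl)

count-∷-≢ : ∀ {a x} w → a ≢ x → count a (x ∷ w) ≡ count a w
count-∷-≢ {a} {x} w a≢x with a ≟ x
... | yes a≡x = ⊥-elim (a≢x a≡x)
... | no _ = refl

count-∷-≥ : ∀ a x w → count a w ≤ count a (x ∷ w)
count-∷-≥ a x w with a ≟ x
... | yes _ = n≤1+n _
... | no _ = ≤-refl

++-≡-++-∷ : ∀ (p s u : Word) x v → p ++ s ≡ u ++ x ∷ v →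
  (Σ Word λ s₁ → u ≡ p ++ s₁ × s ≡ s₁ ++ x ∷ v) ⊎ (Σ Word λ v₁ → p ≡ u ++ x ∷ v₁ × v ≡ v₁ ++ s)
++-≡-++-∷ [] s u x v eq = inj₁ (u , refl , eq)
++-≡-++-∷ (y ∷ p) s [] x v eq with ∷-injectiveˡ eq
... | refl = inj₂ (p , refl , sym (∷-injectiveʳ eq))
++-≡-++-∷ (y ∷ p) s (z ∷ u) x v eq with ∷-injectiveˡ eq | ++-≡-++-∷ p s u x v (∷-injectiveʳ eq)
... | refl | inj₁ (s₁ , u≡ , s≡) = inj₁ (s₁ , cong (y ∷_) u≡ , s≡)
... | refl | inj₂ (v₁ , p≡ , v≡) = inj₂ (v₁ , cong (y ∷_) p≡ , v≡)

excess-transfer : ∀ {a b e m k} → a + b ≤ m + e → e ≤ b + k → a ≤ m + k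
excess-transfer {a} {b} {e} {m} {k} a+b≤m+e e≤b+k = +-cancelʳ-≤ b a (m + k) (begin
  a + b        ≤⟨ a+b≤m+e ⟩
  m + e        ≤⟨ +-monoʳ-≤ m e≤b+k ⟩
  m + (b + k)  ≡⟨ solve (m ∷ b ∷ k ∷ []) ⟩
  m + k + b    ∎)
  where open ≤-Reasoning

excess-shift : ∀ {a k b x y} → a + k < b → b + x ≤ suc (a + y) → x + k ≤ y
excess-shift {a} {k} {b} {x} {y} a+k<b b+x≤ = +-cancelˡ-≤ (suc a) (x + k) y (begin
  suc a + (x + k)  ≡⟨ solve (a ∷ k ∷ x ∷ []) ⟩
  suc (a + k) + x  ≤⟨ +-monoˡ-≤ x a+k<b ⟩
  b + x            ≤⟨ b+x≤ ⟩
  suc (a + y)      ∎)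
  where open ≤-Reasoning

≤-complement : ∀ {k l cp cs dp ds} → k + (cp + cs) ≡ l + (dp + ds) → dp ≤ cp + k → cs ≤ ds + l
≤-complement {k} {l} {cp} {cs} {dp} {ds} balance dp≤cp+k = +-cancelˡ-≤ dp cs (ds + l) (begin
  dp + cs        ≤⟨ +-monoˡ-≤ cs dp≤cp+k ⟩
  cp + k + cs    ≡⟨ solve (cp ∷ k ∷ cs ∷ []) ⟩
  k + (cp + cs)  ≡⟨ balance ⟩
  l + (dp + ds)  ≡⟨ solve (l ∷ dp ∷ ds ∷ []) ⟩
  dp + (ds + l)  ∎)
  where open ≤-Reasoning

length-word-∷ : ∀ r T → length (word (r ∷ T)) ≡ length r + length (word T)
length-word-∷ r T = trans (length-++ (reverse r)) (cong (_+ length (word T)) (length-reverse r))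

refill : ∀ T w → length w ≡ length (word T) →
  Σ Filling λ T′ → map length T′ ≡ map length T × word T′ ≡ w
refill []      []      _     = [] , refl , refl
refill (r ∷ T) w       len≡ with refill T (drop (length r) w) rest-length
  where
  open ≡-Reasoning
  rest-length : length (drop (length r) w) ≡ length (word T)
  rest-length = begin
    length (drop (length r) w)             ≡⟨ length-drop (length r) w ⟩
    length w ∸ length r                    ≡⟨ cong (_∸ length r) (trans len≡ (length-word-∷ r T)) ⟩
    length r + length (word T) ∸ length r  ≡⟨ m+n∸m≡n (length r) (length (word T)) ⟩
    length (word T)                        ∎
... | T′ , shape , word≡ =
  reverse (take (length r) w) ∷ T′ , cong₂ _∷_ row-length shape ,
  trans (cong₂ _++_ (reverse-involutive (take (length r) w)) word≡) (take++drop≡id (length r) w)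
  where
  row-fits : length r ≤ length w
  row-fits = subst (length r ≤_) (sym (trans len≡ (length-word-∷ r T))) (m≤m+n _ _)
  row-length : length (reverse (take (length r) w)) ≡ length r
  row-length = trans (length-reverse (take (length r) w)) (trans (length-take (length r) w) (m≤n⇒m⊓n≡m row-fits))

-- ETab i and FTab i are OnReadingWords (E i) and OnReadingWords (F i).
OnReadingWords : (Word → Word → Set) → Filling → Filling → Set
OnReadingWords S T T′ = map length T′ ≡ map length T × S (word T) (word T′)

iterate-on-words : ∀ {S} m {T T′} → Iter (OnReadingWords S) m T T′ → Iter S m (word T) (word T′)
iterate-on-words zero    T≡T′                   = cong word T≡T′
iterate-on-words (suc m) (_ , (_ , step) , steps) = _ , step , iterate-on-words m steps

iterate-on-tableaux : ∀ {S} → (∀ {w w′} → S w w′ → length w′ ≡ length w) →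
  ∀ m T {w′} → Iter S m (word T) w′ → Σ Filling (Iter (OnReadingWords S) m T)
iterate-on-tableaux S-length zero    T _                  = T , refl
iterate-on-tableaux S-length (suc m) T (w₁ , step , steps) with refill T w₁ (S-length step)
... | T₁ , shape , refl with iterate-on-tableaux S-length m T₁ steps
...   | T′ , tableau-steps = T′ , T₁ , (shape , step) , tableau-steps

module Coplactic (i : ℕ) where

  c d : Word → ℕ
  c = count i
  d = count (suc i)

  c-i∷ : ∀ w → c (i ∷ w) ≡ suc (c w)
  c-i∷ = count-∷-≡ i

  d-i∷ : ∀ w → d (i ∷ w) ≡ d w
  d-i∷ w = count-∷-≢ w 1+n≢n

  c-suc-i∷ : ∀ w → c (suc i ∷ w) ≡ c w
  c-suc-i∷ w = count-∷-≢ w (≢-sym 1+n≢n)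

  d-suc-i∷ : ∀ w → d (suc i ∷ w) ≡ suc (d w)
  d-suc-i∷ = count-∷-≡ (suc i)

  PrefixBounded : ℕ → Word → Set
  PrefixBounded k w = ∀ p s → w ≡ p ++ s → d p ≤ c p + k

  SuffixBounded : ℕ → Word → Set
  SuffixBounded k w = ∀ p s → w ≡ p ++ s → c s ≤ d s + k

  antidominant-[] : AntiDominant i []
  antidominant-[] [] [] refl = z≤n

  dominant-[] : Dominant i []
  dominant-[] [] [] refl = z≤n

  antidominant-∷ : ∀ {x u} → c (x ∷ u) ≤ d (x ∷ u) → AntiDominant i u → AntiDominant i (x ∷ u)
  antidominant-∷ c≤d au []      s eq = subst (λ t → c t ≤ d t) eq c≤d
  antidominant-∷ c≤d au (_ ∷ p) s eq = au p s (∷-injectiveʳ eq)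

  dominant-∷ : ∀ {x w} → (∀ q s → w ≡ q ++ s → d (x ∷ q) ≤ c (x ∷ q)) → Dominant i (x ∷ w)
  dominant-∷ d≤c []      s eq = z≤n
  dominant-∷ d≤c (_ ∷ q) s eq with ∷-injectiveˡ eq
  ... | refl = d≤c q s (∷-injectiveʳ eq)

  antidominant-∷-≢ : ∀ {x u} → x ≢ i → AntiDominant i u → AntiDominant i (x ∷ u)
  antidominant-∷-≢ {x} {u} x≢i au = antidominant-∷ (begin
    c (x ∷ u)  ≡⟨ count-∷-≢ u (≢-sym x≢i) ⟩
    c u        ≤⟨ au [] u refl ⟩
    d u        ≤⟨ count-∷-≥ (suc i) x u ⟩
    d (x ∷ u)  ∎) au
    where open ≤-Reasoning

  dominant-∷-≢ : ∀ {x w} → x ≢ suc i → Dominant i w → Dominant i (x ∷ w)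
  dominant-∷-≢ {x} x≢si dw = dominant-∷ λ q s eq → begin
    d (x ∷ q)  ≡⟨ count-∷-≢ q (≢-sym x≢si) ⟩
    d q        ≤⟨ dw q s eq ⟩
    c q        ≤⟨ count-∷-≥ i x q ⟩
    c (x ∷ q)  ∎
    where open ≤-Reasoning

  antidominant-prefix-excess : ∀ {u} q s → AntiDominant i u → u ≡ q ++ s → d q + c u ≤ c q + d u
  antidominant-prefix-excess q s au refl rewrite count-++ i q s | count-++ (suc i) q s =
    shuffle (d q) (c q) (c s) (d s) (au q s refl)
    where
    shuffle : ∀ dq cq cs ds → cs ≤ ds → dq + (cq + cs) ≤ cq + (dq + ds)
    shuffle dq cq cs ds cs≤ds = ≤-rearrange 0 (dq + cq) cs≤ds
      (solve (dq ∷ cq ∷ cs ∷ [])) (solve (ds ∷ dq ∷ cq ∷ []))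

  -- At the site u x v of a step, u has maximal excess up to the letter x.
  site-prefix-excess : ∀ {u x v w} p s → AntiDominant i u → Dominant i v →
    w ≡ u ++ x ∷ v → w ≡ p ++ s → d p + c u ≤ d (x ∷ []) + (c p + d u)
  site-prefix-excess {u} {x} {v} p s au dv w≡uxv w≡ps
    with ++-≡-++-∷ p s u x v (trans (sym w≡ps) w≡uxv)
  ... | inj₁ (s₁ , u≡ps₁ , _) =
    ≤-trans (antidominant-prefix-excess p s₁ au u≡ps₁) (m≤n+m (c p + d u) (d (x ∷ [])))
  ... | inj₂ (v₁ , refl , v≡v₁s)
    rewrite count-++ i u (x ∷ v₁) | count-++ (suc i) u (x ∷ v₁)
          | count-++ i (x ∷ []) v₁ | count-++ (suc i) (x ∷ []) v₁ =
    shuffle (d u) (d (x ∷ [])) (d v₁) (c u) (c (x ∷ [])) (c v₁) (dv v₁ s v≡v₁s)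
    where
    shuffle : ∀ du dx dv₁ cu cx cv₁ → dv₁ ≤ cv₁ →
      du + (dx + dv₁) + cu ≤ dx + (cu + (cx + cv₁) + du)
    shuffle du dx dv₁ cu cx cv₁ dv₁≤cv₁ =
      ≤-rearrange 0 (du + dx + cu) (+-mono-≤ dv₁≤cv₁ (z≤n {cx}))
        (solve (du ∷ dx ∷ dv₁ ∷ cu ∷ [])) (solve (cv₁ ∷ cx ∷ du ∷ dx ∷ cu ∷ []))

  site-suffix-excess : ∀ {u x v w} p s → AntiDominant i u → Dominant i v →
    w ≡ u ++ x ∷ v → w ≡ p ++ s → c s + d v ≤ c (x ∷ []) + (d s + c v)
  site-suffix-excess {u} {x} {v} p s au dv w≡uxv w≡ps
    with ++-≡-++-∷ p s u x v (trans (sym w≡ps) w≡uxv)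
  ... | inj₁ (s₁ , u≡ps₁ , refl)
    rewrite count-++ i s₁ (x ∷ v) | count-++ (suc i) s₁ (x ∷ v)
          | count-++ i (x ∷ []) v | count-++ (suc i) (x ∷ []) v =
    shuffle (c s₁) (c (x ∷ [])) (c v) (d s₁) (d (x ∷ [])) (d v) (au p s₁ u≡ps₁)
    where
    shuffle : ∀ cs₁ cx cv ds₁ dx dv → cs₁ ≤ ds₁ →
      cs₁ + (cx + cv) + dv ≤ cx + (ds₁ + (dx + dv) + cv)
    shuffle cs₁ cx cv ds₁ dx dv cs₁≤ds₁ =
      ≤-rearrange 0 (cx + cv + dv) (+-mono-≤ cs₁≤ds₁ (z≤n {dx}))
        (solve (cs₁ ∷ cx ∷ cv ∷ dv ∷ [])) (solve (ds₁ ∷ dx ∷ cx ∷ cv ∷ dv ∷ []))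
  ... | inj₂ (v₁ , _ , refl)
    rewrite count-++ i v₁ s | count-++ (suc i) v₁ s =
    shuffle (c s) (d v₁) (d s) (c (x ∷ [])) (c v₁) (dv v₁ s refl)
    where
    shuffle : ∀ cs dv₁ ds cx cv₁ → dv₁ ≤ cv₁ → cs + (dv₁ + ds) ≤ cx + (ds + (cv₁ + cs))
    shuffle cs dv₁ ds cx cv₁ dv₁≤cv₁ =
      ≤-rearrange 0 (cs + ds) (+-mono-≤ dv₁≤cv₁ (z≤n {cx}))
        (solve (cs ∷ dv₁ ∷ ds ∷ [])) (solve (cv₁ ∷ cx ∷ cs ∷ ds ∷ []))

  balanced-site-prefix : ∀ {u x v w} p s → AntiDominant i u → Dominant i v → d u ≤ c u →
    w ≡ u ++ x ∷ v → w ≡ p ++ s → d p ≤ d (x ∷ []) + c p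
  balanced-site-prefix {u} {x} p s au dv du≤cu w≡uxv w≡ps =
    +-cancelʳ-≤ (c u) (d p) (d (x ∷ []) + c p) (begin
      d p + c u                    ≤⟨ site-prefix-excess p s au dv w≡uxv w≡ps ⟩
      d (x ∷ []) + (c p + d u)     ≤⟨ +-monoʳ-≤ (d (x ∷ [])) (+-monoʳ-≤ (c p) du≤cu) ⟩
      d (x ∷ []) + (c p + c u)     ≡⟨ sym (+-assoc (d (x ∷ [])) (c p) (c u)) ⟩
      d (x ∷ []) + c p + c u       ∎)
    where open ≤-Reasoning

  e-applicable-unless-dominant : ∀ w → Dominant i w ⊎ Σ Word (E i w)
  e-applicable-unless-dominant [] = inj₁ dominant-[]
  e-applicable-unless-dominant (x ∷ w) with e-applicable-unless-dominant w
  ... | inj₁ dw with x ≟ suc i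
  ...   | yes refl  = inj₂ (_ , [] , w , antidominant-[] , dw , refl , refl)
  ...   | no x≢si   = inj₁ (dominant-∷-≢ x≢si dw)
  e-applicable-unless-dominant (x ∷ _) | inj₂ (_ , u , v , au , dv , refl , refl) with x ≟ i
  ... | no x≢i = inj₂ (_ , x ∷ u , v , antidominant-∷-≢ x≢i au , dv , refl , refl)
  ... | yes refl with suc (c u) ≤? d u
  ...   | yes c<d = inj₂ (_ , i ∷ u , v ,
            antidominant-∷ (subst₂ _≤_ (sym (c-i∷ u)) (sym (d-i∷ u)) c<d) au , dv , refl , refl)
  ...   | no c≮d  = inj₁ (dominant-∷ λ q s eq →
            subst₂ _≤_ (sym (d-i∷ q)) (sym (c-i∷ q))
              (subst (λ t → d q ≤ t + c q) (d-suc-i∷ [])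
                (balanced-site-prefix q s au dv (≮⇒≥ c≮d) refl eq)))

  f-applicable-unless-antidominant : ∀ w → AntiDominant i w ⊎ Σ Word (F i w)
  f-applicable-unless-antidominant [] = inj₁ antidominant-[]
  f-applicable-unless-antidominant (x ∷ w) with f-applicable-unless-antidominant w | x ≟ i
  ... | inj₁ aw | no x≢i = inj₁ (antidominant-∷-≢ x≢i aw)
  ... | inj₂ (_ , u , v , au , dv , refl , refl) | no x≢i =
    inj₂ (_ , x ∷ u , v , antidominant-∷-≢ x≢i au , dv , refl , refl)
  ... | inj₁ aw | yes refl with suc (c w) ≤? d w
  ...   | yes c<d = inj₁ (antidominant-∷ (subst₂ _≤_ (sym (c-i∷ w)) (sym (d-i∷ w)) c<d) aw)
  ...   | no c≮d  = inj₂ (_ , [] , w , antidominant-[] , w-dominant , refl , refl)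
    where
    w-dominant : Dominant i w
    w-dominant q s eq = +-cancelʳ-≤ (c w) (d q) (c q)
      (≤-trans (antidominant-prefix-excess q s aw eq) (+-monoʳ-≤ (c q) (≮⇒≥ c≮d)))
  f-applicable-unless-antidominant (_ ∷ _) | inj₂ (_ , u , v , au , dv , refl , refl) | yes refl
    with suc (c u) ≤? d u
  ... | yes c<d = inj₂ (_ , i ∷ u , v ,
          antidominant-∷ (subst₂ _≤_ (sym (c-i∷ u)) (sym (d-i∷ u)) c<d) au , dv , refl , refl)
  ... | no c≮d  = inj₂ (_ , [] , u ++ i ∷ v , antidominant-[] ,
          (λ q s eq → subst (λ t → d q ≤ t + c q) (d-i∷ [])
                        (balanced-site-prefix q s au dv (≮⇒≥ c≮d) refl eq)) , refl , refl)

  e-peak : ∀ {k w u v} → PrefixBounded k w → w ≡ u ++ suc i ∷ v → d u < c u + k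
  e-peak {k} {u = u} {v} P w≡ = begin
    suc (d u)                 ≡⟨ +-comm 1 (d u) ⟩
    d u + 1                   ≡⟨ cong (d u +_) (sym (d-suc-i∷ [])) ⟩
    d u + d (suc i ∷ [])      ≡⟨ sym (count-++ (suc i) u (suc i ∷ [])) ⟩
    d (u ++ suc i ∷ [])       ≤⟨ P (u ++ suc i ∷ []) v (trans w≡ (sym (∷ʳ-++ u (suc i) v))) ⟩
    c (u ++ suc i ∷ []) + k   ≡⟨ cong (_+ k) (count-++ i u (suc i ∷ [])) ⟩
    c u + c (suc i ∷ []) + k  ≡⟨ cong (λ t → c u + t + k) (c-suc-i∷ []) ⟩
    c u + 0 + k               ≡⟨ cong (_+ k) (+-identityʳ (c u)) ⟩
    c u + k                   ∎
    where open ≤-Reasoning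

  f-peak : ∀ {k w u v} → SuffixBounded k w → w ≡ u ++ i ∷ v → c v < d v + k
  f-peak {k} {u = u} {v} P w≡ = subst₂ (λ a b → a ≤ b + k) (c-i∷ v) (d-i∷ v) (P u (i ∷ v) w≡)

  e-step-unbounded : ∀ {w w₁} → E i w w₁ → ¬ PrefixBounded 0 w
  e-step-unbounded (u , _ , au , _ , w≡ , _) P =
    <⇒≱ (subst (d u <_) (+-identityʳ (c u)) (e-peak P w≡)) (au [] u refl)

  f-step-unbounded : ∀ {w w₁} → F i w w₁ → ¬ SuffixBounded 0 w
  f-step-unbounded (_ , v , _ , dv , w≡ , _) P =
    <⇒≱ (subst (c v <_) (+-identityʳ (d v)) (f-peak P w≡)) (dv v [] (sym (++-identityʳ v)))

  e-step-lowers-bound : ∀ {k w w₁} → E i w w₁ → PrefixBounded (suc k) w → PrefixBounded k w₁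
  e-step-lowers-bound {k} (u , v , au , dv , w≡ , w₁≡) P q s w₁≡qs = excess-transfer
    (subst (λ t → d q + c u ≤ t + (c q + d u)) (d-i∷ []) (site-prefix-excess q s au dv w₁≡ w₁≡qs))
    (≤-pred (subst (d u <_) (+-suc (c u) k) (e-peak P w≡)))

  f-step-lowers-bound : ∀ {k w w₁} → F i w w₁ → SuffixBounded (suc k) w → SuffixBounded k w₁
  f-step-lowers-bound {k} (u , v , au , dv , w≡ , w₁≡) P p s w₁≡ps = excess-transfer
    (subst (λ t → c s + d v ≤ t + (d s + c v)) (c-suc-i∷ []) (site-suffix-excess p s au dv w₁≡ w₁≡ps))
    (≤-pred (subst (c v <_) (+-suc (d v) k) (f-peak P w≡)))

  e-iteration-unbounded : ∀ k {w w′} → Iter (E i) (suc k) w w′ → ¬ PrefixBounded k w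
  e-iteration-unbounded zero    (_ , step , _)     = e-step-unbounded step
  e-iteration-unbounded (suc k) (_ , step , steps) =
    e-iteration-unbounded k steps ∘ e-step-lowers-bound step

  f-iteration-unbounded : ∀ k {w w′} → Iter (F i) (suc k) w w′ → ¬ SuffixBounded k w
  f-iteration-unbounded zero    (_ , step , _)     = f-step-unbounded step
  f-iteration-unbounded (suc k) (_ , step , steps) =
    f-iteration-unbounded k steps ∘ f-step-lowers-bound step

  e-step-from-excess : ∀ {k w} p s → w ≡ p ++ s → c p + k < d p →
    Σ Word λ u → Σ Word λ v → E i w (u ++ i ∷ v) × c u + k ≤ d u
  e-step-from-excess {w = w} p s w≡ps excess with e-applicable-unless-dominant w
  ... | inj₁ dom = ⊥-elim (<⇒≱ (≤-trans (s≤s (m≤m+n (c p) _)) excess) (dom p s w≡ps))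
  ... | inj₂ (_ , step@(u , v , au , dv , w≡ , refl)) = u , v , step ,
    excess-shift excess (subst (λ t → d p + c u ≤ t + (c p + d u)) (d-suc-i∷ [])
                          (site-prefix-excess p s au dv w≡ w≡ps))

  f-step-from-excess : ∀ {k w} p s → w ≡ p ++ s → d s + k < c s →
    Σ Word λ u → Σ Word λ v → F i w (u ++ suc i ∷ v) × d v + k ≤ c v
  f-step-from-excess {w = w} p s w≡ps excess with f-applicable-unless-antidominant w
  ... | inj₁ anti = ⊥-elim (<⇒≱ (≤-trans (s≤s (m≤m+n (d s) _)) excess) (anti p s w≡ps))
  ... | inj₂ (_ , step@(u , v , au , dv , w≡ , refl)) = u , v , step ,
    excess-shift excess (subst (λ t → c s + d v ≤ t + (d s + c v)) (c-i∷ [])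
                          (site-suffix-excess p s au dv w≡ w≡ps))

  e-iterable : ∀ k {w} p s → w ≡ p ++ s → c p + k < d p → Σ Word (Iter (E i) (suc k) w)
  e-iterable k p s w≡ps excess with e-step-from-excess p s w≡ps excess
  e-iterable zero    _ _ _ _ | _ , _ , step , _ = _ , _ , step , refl
  e-iterable (suc k) _ _ _ _ | u , v , step , peak
    with e-iterable k u (i ∷ v) refl (subst (_≤ d u) (+-suc (c u) k) peak)
  ... | w′ , steps = w′ , _ , step , steps

  f-iterable : ∀ k {w} p s → w ≡ p ++ s → d s + k < c s → Σ Word (Iter (F i) (suc k) w)
  f-iterable k p s w≡ps excess with f-step-from-excess p s w≡ps excess
  f-iterable zero    _ _ _ _ | _ , _ , step , _ = _ , _ , step , refl
  f-iterable (suc k) _ _ _ _ | u , v , step , peak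
    with f-iterable k (u ++ suc i ∷ []) v (sym (∷ʳ-++ u (suc i) v)) (subst (_≤ c v) (+-suc (d v) k) peak)
  ... | w′ , steps = w′ , _ , step , steps

  e-preserves-length : ∀ {w w′} → E i w w′ → length w′ ≡ length w
  e-preserves-length (u , _ , _ , _ , refl , refl) = trans (length-++ u) (sym (length-++ u))

  f-preserves-length : ∀ {w w′} → F i w w′ → length w′ ≡ length w
  f-preserves-length (u , _ , _ , _ , refl , refl) = trans (length-++ u) (sym (length-++ u))

  e-bounded⇔prefix-bounded : ∀ k T → AtMost (ETab i) k T ⇔ PrefixBounded k (word T)
  e-bounded⇔prefix-bounded k T = mk⇔ bounded at-most
    where
    bounded : AtMost (ETab i) k T → PrefixBounded k (word T)
    bounded no-iteration p s eq with d p ≤? c p + k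
    ... | yes d≤c+k = d≤c+k
    ... | no d≰c+k  = ⊥-elim (no-iteration (iterate-on-tableaux e-preserves-length (suc k) T
                        (proj₂ (e-iterable k p s eq (≰⇒> d≰c+k)))))
    at-most : PrefixBounded k (word T) → AtMost (ETab i) k T
    at-most P (_ , steps) = e-iteration-unbounded k (iterate-on-words (suc k) steps) P

  f-bounded⇔suffix-bounded : ∀ k T → AtMost (FTab i) k T ⇔ SuffixBounded k (word T)
  f-bounded⇔suffix-bounded k T = mk⇔ bounded at-most
    where
    bounded : AtMost (FTab i) k T → SuffixBounded k (word T)
    bounded no-iteration p s eq with c s ≤? d s + k
    ... | yes c≤d+k = c≤d+k
    ... | no c≰d+k  = ⊥-elim (no-iteration (iterate-on-tableaux f-preserves-length (suc k) T
                        (proj₂ (f-iterable k p s eq (≰⇒> c≰d+k)))))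
    at-most : SuffixBounded k (word T) → AtMost (FTab i) k T
    at-most P (_ , steps) = f-iteration-unbounded k (iterate-on-words (suc k) steps) P

  prefix-bounded⇔suffix-bounded : ∀ {k l w} → k + c w ≡ l + d w →
    PrefixBounded k w ⇔ SuffixBounded l w
  prefix-bounded⇔suffix-bounded {k} {l} {w} balance = mk⇔
    (λ P p s eq → ≤-complement {k} {l} {c p} {c s} {d p} {d s} (split-balance p s eq) (P p s eq))
    (λ S p s eq → ≤-complement {l} {k} {d s} {d p} {c s} {c p} (swap-balance (c p) (c s) (d p) (d s) (split-balance p s eq)) (S p s eq))
    where
    split-balance : ∀ p s → w ≡ p ++ s → k + (c p + c s) ≡ l + (d p + d s)
    split-balance p s eq = begin
      k + (c p + c s)  ≡⟨ cong (k +_) (sym (count-++ i p s)) ⟩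
      k + c (p ++ s)   ≡⟨ cong (λ t → k + c t) (sym eq) ⟩
      k + c w          ≡⟨ balance ⟩
      l + d w          ≡⟨ cong (λ t → l + d t) eq ⟩
      l + d (p ++ s)   ≡⟨ cong (l +_) (count-++ (suc i) p s) ⟩
      l + (d p + d s)  ∎
      where open ≡-Reasoning
    swap-balance : ∀ a b x y → k + (a + b) ≡ l + (x + y) → l + (y + x) ≡ k + (b + a)
    swap-balance a b x y e =
      sym (trans (cong (k +_) (+-comm b a)) (trans e (cong (l +_) (+-comm x y))))

∀<-cong-⇔ : ∀ {n} {A B : ℕ → Set} → (∀ i → suc i < n → A i ⇔ B i) →
  (∀ i → suc i < n → A i) ⇔ (∀ i → suc i < n → B i)
∀<-cong-⇔ A⇔B = mk⇔ (λ as i h → Equivalence.to (A⇔B i h) (as i h))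
                    (λ bs i h → Equivalence.from (A⇔B i h) (bs i h))

+-cancelˡ-≤-⇔ : ∀ b t x y → b + x ≤ (b + t) + y ⇔ x ≤ y + t
+-cancelˡ-≤-⇔ b t x y = mk⇔
  (λ h → +-cancelˡ-≤ b x (y + t) (subst (b + x ≤_) b+t+y≡b+[y+t] h))
  (λ h → subst (b + x ≤_) (sym b+t+y≡b+[y+t]) (+-monoʳ-≤ b h))
  where
  b+t+y≡b+[y+t] : (b + t) + y ≡ b + (y + t)
  b+t+y≡b+[y+t] = solve (b ∷ t ∷ y ∷ [])

kappa-dominant⇔prefix-bounded : ∀ {n} (κ : Vec ℕ n) T → IsPartitionV κ →
  KappaDominant κ T ⇔ (∀ i → suc i < n → Coplactic.PrefixBounded i (κ ! i ∸ κ ! suc i) (word T))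
kappa-dominant⇔prefix-bounded κ T κ-partition = mk⇔
  (λ kd i h p s eq → Equivalence.to (step i h p) (kd p s eq i h))
  (λ P p s eq i h → Equivalence.from (step i h p) (P i h p s eq))
  where
  step : ∀ i → suc i < _ → ∀ p →
    (κ ! suc i + count (suc i) p ≤ κ ! i + count i p) ⇔
    (count (suc i) p ≤ count i p + (κ ! i ∸ κ ! suc i))
  step i h p = subst
    (λ z → (κ ! suc i + count (suc i) p ≤ z + count i p) ⇔
           (count (suc i) p ≤ count i p + (κ ! i ∸ κ ! suc i)))
    (m+[n∸m]≡n (κ-partition i h))
    (+-cancelˡ-≤-⇔ (κ ! suc i) (κ ! i ∸ κ ! suc i) (count (suc i) p) (count i p))

weight-balance : ∀ {n} (κ ν : Vec ℕ n) T → IsPartitionV κ → IsPartitionV ν → WtEq κ ν T →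
  ∀ i → suc i < n →
  (κ ! i ∸ κ ! suc i) + count i (word T) ≡ (ν ! i ∸ ν ! suc i) + count (suc i) (word T)
weight-balance κ ν T κ-partition ν-partition wt i h =
  +-cancelˡ-≡ (κ ! suc i) _ _ (begin
    κ ! suc i + (tκ + cw)   ≡⟨ sym (+-assoc (κ ! suc i) tκ cw) ⟩
    κ ! suc i + tκ + cw     ≡⟨ cong (_+ cw) (m+[n∸m]≡n (κ-partition i h)) ⟩
    κ ! i + cw              ≡⟨ sym (wt i (<-trans (n<1+n i) h)) ⟩
    ν ! i                   ≡⟨ sym (m+[n∸m]≡n (ν-partition i h)) ⟩
    ν ! suc i + tν          ≡⟨ cong (_+ tν) (wt (suc i) h) ⟩
    κ ! suc i + dw + tν     ≡⟨ +-assoc (κ ! suc i) dw tν ⟩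
    κ ! suc i + (dw + tν)   ≡⟨ cong (κ ! suc i +_) (+-comm dw tν) ⟩
    κ ! suc i + (tν + dw)   ∎)
  where
  open ≡-Reasoning
  tκ tν cw dw : ℕ
  tκ = κ ! i ∸ κ ! suc i
  tν = ν ! i ∸ ν ! suc i
  cw = count i (word T)
  dw = count (suc i) (word T)

mainTheorem7 : (n : ℕ) → 1 ≤ n →
    (lam mu : List ℕ) → IsSkewShape lam mu →
    (T : Filling) → IsTab n lam mu T →
    (κ ν : Vec ℕ n) → IsPartitionV κ → IsPartitionV ν →
    (∀ i → i < n → κ ! i ≤ ν ! i) → WtEq κ ν T →
    (NuKappaDominant κ ν T ⇔
       (∀ i → suc i < n → AtMost (ETab i) (κ ! i ∸ κ ! suc i) T))
    × (NuKappaDominant κ ν T ⇔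
       (∀ i → suc i < n → AtMost (FTab i) (ν ! i ∸ ν ! suc i) T))
mainTheorem7 n _ _ _ _ T _ κ ν κ-partition ν-partition _ wt =
  e-bounds ⇔-∘ prefix-bounds , f-bounds ⇔-∘ prefix-bounds
  where
  open Coplactic
  prefix-bounds : NuKappaDominant κ ν T ⇔ (∀ i → suc i < n → PrefixBounded i (κ ! i ∸ κ ! suc i) (word T))
  prefix-bounds = kappa-dominant⇔prefix-bounded κ T κ-partition ⇔-∘ mk⇔ proj₁ (_, wt)
  e-bounds : (∀ i → suc i < n → PrefixBounded i (κ ! i ∸ κ ! suc i) (word T)) ⇔
             (∀ i → suc i < n → AtMost (ETab i) (κ ! i ∸ κ ! suc i) T)
  e-bounds = ∀<-cong-⇔ λ i _ → ⇔-sym (e-bounded⇔prefix-bounded i _ T)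
  f-bounds : (∀ i → suc i < n → PrefixBounded i (κ ! i ∸ κ ! suc i) (word T)) ⇔
             (∀ i → suc i < n → AtMost (FTab i) (ν ! i ∸ ν ! suc i) T)
  f-bounds = ∀<-cong-⇔ λ i h → ⇔-sym (f-bounded⇔suffix-bounded i _ T)
    ⇔-∘ prefix-bounded⇔suffix-bounded i (weight-balance κ ν T κ-partition ν-partition wt i h)
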